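{- For every $n\ge4$, $\mathrm{GS}(n,3)=(\mathbb{F}_3^n,A_{\mathrm{GS}}(n,3))$ has $3$-$\mathrm{HOP}_2$; and for every $n\ge1$, $\mathrm{GS}(n,3)$ has no $4$-$\mathrm{HOP}_2$.
   Context: For $1\le i\le n$ let $H_i=\{x\in\mathbb{F}_3^n:x_1=\dots=x_i=0\}$, $e_i$ the $i$-th standard basis vector, and $A_{\mathrm{GS}}(n,3)=\bigcup_{i=1}^n(H_i+e_i)$. A pair $(G,A)$ has $k$-$\mathrm{HOP}_2$ if there are $a_1,\dots,a_k,b_1,\dots,b_k,c_1,\dots,c_k\in G$ with $a_u+b_v+c_w\in A\iff u<v+w$. -}

module Defs where

open import Data.Nat using (ℕ; suc; _<_; _≤_)
open import Data.Fin using (Fin; toℕ; zero)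
open import Data.Nat.DivMod using (_%_)
open import Data.Fin using (fromℕ<)
open import Data.Nat.DivMod using (m%n<n)
open import Data.Product using (Σ; ∃; _×_)
open import Function.Bundles using (_⇔_)
open import Relation.Binary.PropositionalEquality using (_≡_)

𝔽₃ : Set
𝔽₃ = Fin 3

_+₃_ : 𝔽₃ → 𝔽₃ → 𝔽₃
x +₃ y = fromℕ< (m%n<n (toℕ x Data.Nat.+ toℕ y) 3)

Vec₃ : ℕ → Set
Vec₃ n = Fin n → 𝔽₃

_⊕_ : ∀ {n} → Vec₃ n → Vec₃ n → Vec₃ n
(x ⊕ y) j = x j +₃ y j

-- Membership in H_i + e_i (i = toℕ i' + 1, one-based as in the paper):
-- x - e_i ∈ H_i, i.e. x_j = 0 for j < i and x_i - 1 = 0, i.e. x_i = 1.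
-- Here coordinates are 0-based: j runs over Fin n, the paper's index is toℕ j + 1.
InHiPlusEi : ∀ {n} → Fin n → Vec₃ n → Set
InHiPlusEi {n} i x =
  (∀ (j : Fin n) → toℕ j < toℕ i → x j ≡ zero) × (x i ≡ Data.Fin.suc zero)

A-GS : ∀ n → Vec₃ n → Set
A-GS n x = ∃ λ (i : Fin n) → InHiPlusEi i x

-- (G, A) has k-HOP₂, for G = 𝔽₃ⁿ. Indices u,v,w ∈ {1..k} are represented
-- by Fin k with paper-index toℕ u + 1; u < v + w becomes
-- suc (toℕ u) < suc (toℕ v) + suc (toℕ w).
HasHOP₂ : ∀ n → (Vec₃ n → Set) → ℕ → Set
HasHOP₂ n A k =
  Σ (Fin k → Vec₃ n) λ a → Σ (Fin k → Vec₃ n) λ b → Σ (Fin k → Vec₃ n) λ c →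
    ∀ (u v w : Fin k) →
      A ((a u ⊕ b v) ⊕ c w) ⇔ (suc (toℕ u) < suc (toℕ v) Data.Nat.+ suc (toℕ w))

{-# OPTIONS --safe #-}
module Submission where

-- A point of 𝔽₃ⁿ lies in A_GS(n,3) exactly when its first nonzero coordinate is 1.
-- For 3-HOP₂ an explicit configuration in 𝔽₃⁴ suffices, and prepending zero
-- coordinates carries it to every larger dimension.  For 4-HOP₂, restrict to
-- u ∈ {2,3,4} and v, w ∈ {1,2,3}: the sums a_u + b_v + c_w then realise the
-- pattern i < j + k on {0,1,2}³.  A sum whose first coordinate is 1 lies in A and
-- one whose first coordinate is 2 does not, and an exhaustive check over 𝔽₃⁹ shows
-- that this forces every first coordinate to vanish.  So the pattern is realised
-- again by the remaining coordinates, and finally in 𝔽₃⁰, where A is empty.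

open import Defs
open import Data.Nat using (ℕ; zero; suc; _+_; _≤_; _<_; _<?_; _≤′_; ≤′-reflexive; ≤′-step; z≤n; s≤s; s<s; s<s⁻¹)
open import Data.Nat.Properties using (≤⇒≤′; +-suc)
open import Data.Fin using (Fin; suc; toℕ; inject₁; _≟_)
open import Data.Fin.Patterns using (0F; 1F; 2F)
open import Data.Fin.Properties using (all?; toℕ-inject₁)
open import Data.Vec.Functional using (head; tail; _∷_; [])
open import Data.Product using (_×_; _,_)
open import Data.Sum using (_⊎_; inj₁; inj₂)
open import Data.Unit using (⊤)
open import Function using (_∘_)
open import Function.Bundles using (_⇔_; mk⇔; Equivalence)
open import Function.Properties.Equivalence using () renaming (sym to ⇔-sym; trans to ⇔-trans)
open import Relation.Nullary using (¬_; Dec; yes; no; ¬?; _→-dec_; _×-dec_; _⊎-dec_)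
open import Relation.Nullary.Decidable using (map; map′; from-yes)
open import Relation.Binary.PropositionalEquality using (_≡_; refl; sym; trans; subst; cong₂)

open Equivalence using (to; from)

private
  variable
    A B : Set

_⇔-dec_ : Dec A → Dec B → Dec (A ⇔ B)
A? ⇔-dec B? =
  map′ (λ (f , g) → mk⇔ f g) (λ A⇔B → to A⇔B , from A⇔B) ((A? →-dec B?) ×-dec (B? →-dec A?))

A-GS-zero-empty : (x : Vec₃ 0) → ¬ A-GS 0 x
A-GS-zero-empty x (() , _)

A-GS-suc : ∀ {n} (x : Vec₃ (suc n)) →
  A-GS (suc n) x ⇔ (x 0F ≡ 1F ⊎ (x 0F ≡ 0F × A-GS n (tail x)))
A-GS-suc {n} x = mk⇔ split join
  where
  split : A-GS (suc n) x → x 0F ≡ 1F ⊎ (x 0F ≡ 0F × A-GS n (tail x))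
  split (0F    , _   , x₀≡1) = inj₁ x₀≡1
  split (suc i , low , xᵢ≡1) = inj₂ (low 0F (s≤s z≤n) , i , (λ j j<i → low (suc j) (s≤s j<i)) , xᵢ≡1)

  join : x 0F ≡ 1F ⊎ (x 0F ≡ 0F × A-GS n (tail x)) → A-GS (suc n) x
  join (inj₁ x₀≡1) = 0F , (λ _ ()) , x₀≡1
  join (inj₂ (x₀≡0 , i , low , xᵢ≡1)) = suc i , low′ , xᵢ≡1
    where
    low′ : ∀ j → toℕ j < toℕ (suc i) → x j ≡ 0F
    low′ 0F      _          = x₀≡0
    low′ (suc j) (s≤s j<i) = low j j<i

A-GS? : ∀ n (x : Vec₃ n) → Dec (A-GS n x)
A-GS? zero    x = no (A-GS-zero-empty x)
A-GS? (suc n) x = map (⇔-sym (A-GS-suc x)) (x 0F ≟ 1F ⊎-dec (x 0F ≟ 0F ×-dec A-GS? n (tail x)))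

A-GS-tail : ∀ {n} {x : Vec₃ (suc n)} → x 0F ≡ 0F → A-GS (suc n) x ⇔ A-GS n (tail x)
A-GS-tail {x = x} x₀≡0 = mk⇔ drop (λ x∈A → from (A-GS-suc x) (inj₂ (x₀≡0 , x∈A)))
  where
  drop : A-GS _ x → A-GS _ (tail x)
  drop x∈A with to (A-GS-suc x) x∈A
  ... | inj₁ x₀≡1      with () ← trans (sym x₀≡0) x₀≡1
  ... | inj₂ (_ , x∈A) = x∈A

-- Which leading coordinates a point with membership P can have.
Consistent : 𝔽₃ → Set → Set
Consistent 0F P = ⊤
Consistent 1F P = P
Consistent 2F P = ¬ P

consistent? : ∀ {P} → Dec P → ∀ x → Dec (Consistent x P)
consistent? P? 0F = yes _
consistent? P? 1F = P?
consistent? P? 2F = ¬? P?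

A-GS-head : ∀ {n P} {x : Vec₃ (suc n)} → A-GS (suc n) x ⇔ P → Consistent (x 0F) P
A-GS-head {x = x} x∈A⇔P with x 0F in x₀≡
... | 0F = _
... | 1F = to x∈A⇔P (from (A-GS-suc x) (inj₁ x₀≡))
... | 2F = λ p → excluded (to (A-GS-suc x) (from x∈A⇔P p))
  where
  excluded : ¬ (x 0F ≡ 1F ⊎ (x 0F ≡ 0F × A-GS _ (tail x)))
  excluded (inj₁ x₀≡1)       with () ← trans (sym x₀≡) x₀≡1
  excluded (inj₂ (x₀≡0 , _)) with () ← trans (sym x₀≡) x₀≡0

IsHOP₂ : ∀ {n k} → (a b c : Fin k → Vec₃ n) → Set
IsHOP₂ {n} a b c = ∀ u v w →
  A-GS n ((a u ⊕ b v) ⊕ c w) ⇔ (suc (toℕ u) < suc (toℕ v) + suc (toℕ w))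

isHOP₂? : ∀ {n k} (a b c : Fin k → Vec₃ n) → Dec (IsHOP₂ a b c)
isHOP₂? {n} a b c = all? λ u → all? λ v → all? λ w →
  A-GS? n ((a u ⊕ b v) ⊕ c w) ⇔-dec (suc (toℕ u) <? suc (toℕ v) + suc (toℕ w))

HasHOP₂-suc : ∀ {n k} → HasHOP₂ n (A-GS n) k → HasHOP₂ (suc n) (A-GS (suc n)) k
HasHOP₂-suc (a , b , c , hop) =
  (0F ∷_) ∘ a , (0F ∷_) ∘ b , (0F ∷_) ∘ c , λ u v w → ⇔-trans (A-GS-tail refl) (hop u v w)

HasHOP₂-mono : ∀ {m n k} → m ≤′ n → HasHOP₂ m (A-GS m) k → HasHOP₂ n (A-GS n) k
HasHOP₂-mono (≤′-reflexive refl) hop = hop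
HasHOP₂-mono (≤′-step m≤′n)     hop = HasHOP₂-suc (HasHOP₂-mono m≤′n hop)

GS₄-HasHOP₂-3 : HasHOP₂ 4 (A-GS 4) 3
GS₄-HasHOP₂-3 = a , b , c , from-yes (isHOP₂? a b c)
  where
  a b c : Fin 3 → Vec₃ 4
  a = (0F ∷ 0F ∷ 0F ∷ 0F ∷ []) ∷ (0F ∷ 0F ∷ 0F ∷ 1F ∷ []) ∷ (0F ∷ 2F ∷ 0F ∷ 0F ∷ []) ∷ []
  b = (0F ∷ 0F ∷ 0F ∷ 0F ∷ []) ∷ (0F ∷ 1F ∷ 0F ∷ 1F ∷ []) ∷ (0F ∷ 1F ∷ 0F ∷ 0F ∷ []) ∷ []
  c = (0F ∷ 0F ∷ 0F ∷ 1F ∷ []) ∷ (0F ∷ 0F ∷ 1F ∷ 0F ∷ []) ∷ (1F ∷ 0F ∷ 0F ∷ 0F ∷ []) ∷ []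

Sums : Set
Sums = Fin 3 → Fin 3 → Fin 3 → 𝔽₃

sums : (α β γ : Fin 3 → 𝔽₃) → Sums
sums α β γ i j k = (α i +₃ β j) +₃ γ k

ForcedZero : Sums → Set
ForcedZero s =
  (∀ i j k → Consistent (s i j k) (toℕ i < toℕ j + toℕ k)) → ∀ i j k → s i j k ≡ 0F

forcedZero? : ∀ s → Dec (ForcedZero s)
forcedZero? s =
  (all? λ i → all? λ j → all? λ k → consistent? (toℕ i <? toℕ j + toℕ k) (s i j k))
  →-dec (all? λ i → all? λ j → all? λ k → s i j k ≟ 0F)

ForcedZero-resp : ∀ {s t} → (∀ i j k → s i j k ≡ t i j k) → ForcedZero s → ForcedZero t
ForcedZero-resp {s} {t} s≡t forced consistent i j k =
  trans (sym (s≡t i j k))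
    (forced (λ i j k → subst (λ x → Consistent x _) (sym (s≡t i j k)) (consistent i j k)) i j k)

tabulate₃ : (α : Fin 3 → 𝔽₃) → Fin 3 → 𝔽₃
tabulate₃ α = α 0F ∷ α 1F ∷ α 2F ∷ []

tabulate₃-eta : ∀ α i → tabulate₃ α i ≡ α i
tabulate₃-eta α 0F = refl
tabulate₃-eta α 1F = refl
tabulate₃-eta α 2F = refl

sums-forcedZero : ∀ α β γ → ForcedZero (sums α β γ)
sums-forcedZero α β γ =
  ForcedZero-resp
    (λ i j k → cong₂ _+₃_ (cong₂ _+₃_ (tabulate₃-eta α i) (tabulate₃-eta β j)) (tabulate₃-eta γ k))
    (exhaustive (α 0F) (α 1F) (α 2F) (β 0F) (β 1F) (β 2F) (γ 0F) (γ 1F) (γ 2F))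
  where
  exhaustive : ∀ x₀ x₁ x₂ y₀ y₁ y₂ z₀ z₁ z₂ →
    ForcedZero (sums (x₀ ∷ x₁ ∷ x₂ ∷ []) (y₀ ∷ y₁ ∷ y₂ ∷ []) (z₀ ∷ z₁ ∷ z₂ ∷ []))
  exhaustive = from-yes
    (all? λ x₀ → all? λ x₁ → all? λ x₂ → all? λ y₀ → all? λ y₁ → all? λ y₂ →
     all? λ z₀ → all? λ z₁ → all? λ z₂ →
     forcedZero? (sums (x₀ ∷ x₁ ∷ x₂ ∷ []) (y₀ ∷ y₁ ∷ y₂ ∷ []) (z₀ ∷ z₁ ∷ z₂ ∷ [])))

Realises-i<j+k : ∀ {n} → (a b c : Fin 3 → Vec₃ n) → Set
Realises-i<j+k {n} a b c = ∀ i j k → A-GS n ((a i ⊕ b j) ⊕ c k) ⇔ (toℕ i < toℕ j + toℕ k)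

¬Realises-i<j+k : ∀ n (a b c : Fin 3 → Vec₃ n) → ¬ Realises-i<j+k a b c
¬Realises-i<j+k zero    a b c realises = A-GS-zero-empty _ (from (realises 0F 1F 0F) (s≤s z≤n))
¬Realises-i<j+k (suc n) a b c realises =
  ¬Realises-i<j+k n (tail ∘ a) (tail ∘ b) (tail ∘ c) λ i j k →
    ⇔-trans (⇔-sym (A-GS-tail (heads-vanish i j k))) (realises i j k)
  where
  heads-vanish : ∀ i j k → sums (head ∘ a) (head ∘ b) (head ∘ c) i j k ≡ 0F
  heads-vanish = sums-forcedZero (head ∘ a) (head ∘ b) (head ∘ c) λ i j k → A-GS-head (realises i j k)

shifted-index-< : ∀ (i j k : Fin 3) →
  suc (toℕ (suc i)) < suc (toℕ (inject₁ j)) + suc (toℕ (inject₁ k)) ⇔ toℕ i < toℕ j + toℕ k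
shifted-index-< i j k rewrite toℕ-inject₁ j | toℕ-inject₁ k | +-suc (toℕ j) (toℕ k) =
  mk⇔ (s<s⁻¹ ∘ s<s⁻¹) (s<s ∘ s<s)

¬HasHOP₂-4 : ∀ n → ¬ HasHOP₂ n (A-GS n) 4
¬HasHOP₂-4 n (a , b , c , hop) =
  ¬Realises-i<j+k n (a ∘ suc) (b ∘ inject₁) (c ∘ inject₁) λ i j k →
    ⇔-trans (hop (suc i) (inject₁ j) (inject₁ k)) (shifted-index-< i j k)

proposition2p20 :
    (∀ (n : ℕ) → 4 ≤ n → HasHOP₂ n (A-GS n) 3) ×
    (∀ (n : ℕ) → 1 ≤ n → ¬ HasHOP₂ n (A-GS n) 4)
proposition2p20 =
  (λ n 4≤n → HasHOP₂-mono (≤⇒≤′ 4≤n) GS₄-HasHOP₂-3) ,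
  (λ n _ → ¬HasHOP₂-4 n)
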